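{- There exists a set $A$ of integers such that the asymptotic density of $A$ exists but the asymptotic density of $A+A=\{a+b: a,b\in A\}$ does not exist (i.e., the lower and upper asymptotic densities of $A+A$ differ).
   Context: For a set $A$ of nonnegative integers, the lower and upper asymptotic densities are $\liminf_{n\to\infty}|A\cap[1,n]|/n$ and $\limsup_{n\to\infty}|A\cap[1,n]|/n$; the asymptotic density exists if they coincide. -}

module Defs where

open import Data.Bool using (Bool; true; false; _∧_; _∨_)
open import Data.Nat using (ℕ; zero; suc; _∸_; _≥_)
open import Data.Integer using (+_)
open import Data.Rational using (ℚ; _/_; _-_; ∣_∣; _<_; _≤_; 0ℚ)
open import Data.Product using (Σ; ∃; _×_)

Subset : Set
Subset = ℕ → Bool

-- Membership in the sumset A + B = { a + b : a ∈ A, b ∈ B }: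
-- n ∈ A + B iff there is a ≤ n with a ∈ A and n - a ∈ B (bounded search).
sumsetUpTo : Subset → Subset → ℕ → ℕ → Bool
sumsetUpTo A B n zero    = A zero ∧ B n
sumsetUpTo A B n (suc a) = (A (suc a) ∧ B (n ∸ suc a)) ∨ sumsetUpTo A B n a

_⊕_ : Subset → Subset → Subset
(A ⊕ B) n = sumsetUpTo A B n n

-- |A ∩ [1, n]|
count : Subset → ℕ → ℕ
count A zero    = zero
count A (suc n) with A (suc n)
... | true  = suc (count A n)
... | false = count A n

-- ratio n = |A ∩ [1, n+1]| / (n+1)
ratio : Subset → ℕ → ℚ
ratio A n = + count A (suc n) / suc n

-- The asymptotic density of A exists: the sequence |A ∩ [1,n]|/n converges
-- (in ℝ), expressed as the Cauchy condition with rational ε.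
DensityExists : Subset → Set
DensityExists A = ∀ (ε : ℚ) → 0ℚ < ε →
  ∃ λ N → ∀ m n → m ≥ N → n ≥ N → ∣ ratio A m - ratio A n ∣ < ε

LowerLtUpper : Subset → Set
LowerLtUpper A = Σ ℚ λ α → Σ ℚ λ β → α < β ×
  (∀ N → ∃ λ m → m ≥ N × ratio A m ≤ α) ×
  (∀ N → ∃ λ n → n ≥ N × β ≤ ratio A n)

-- Take blocks [X k, 2 X k) with X k = L k ² and L k = 4 ^ k, and let A contain from
-- block k only the offsets below L k and the multiples of L k.  Block k holds about
-- 2 L k = 2 √(X k) elements, so A has density 0.  But every offset below X k is
-- r + q L k with r, q < L k, so A + A contains all of [2 X k, 3 X k), while the
-- elements of A + A up to X (k + 1) = 16 X k are sums of elements of blocks ≤ k and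
-- hence lie below 4 X k.  So the counting ratio of A + A is at least 1/3 at 3 X k
-- and at most 1/4 at X (k + 1).
module Submission where

open import Defs
open import Data.Bool using (true; false; _∧_)
open import Data.Bool.Properties using (∨-zeroʳ; ¬-not)
open import Data.Fin using (Fin; toℕ; fromℕ<)
open import Data.Fin.Properties using (any?; toℕ-fromℕ<)
open import Data.Integer as ℤ using (+_; +≤+; +<+; -[1+_])
import Data.Integer.Properties as ℤ
open import Data.Nat
  using (ℕ; zero; suc; pred; _+_; _*_; _∸_; _≤_; _<_; _≥_; z≤n; s≤s; _≟_; _≤?_; _<?_)
open import Data.Nat.Divisibility using (_∣_; _∣?_; n∣m*n; ∣m+n∣m⇒∣n; >⇒∤)
open import Data.Nat.DivMod using (_%_; _/_; m%n<n; m/n*n≤m; m≡m%n+[m/n]*n)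
open import Data.Nat.Properties
open import Data.Nat.Tactic.RingSolver using (solve-∀)
open import Data.Product using (Σ; ∃; ∃-syntax; _×_; _,_)
open import Data.Rational as ℚ using (mkℚ; 0ℚ; ∣_∣; *<*)
import Data.Rational.Properties as ℚ
open import Data.Rational.Unnormalised using (mkℚᵘ; *≤*; *<*)
import Data.Rational.Unnormalised.Properties as ℚᵘ
open import Data.Sum using (_⊎_; inj₁; inj₂)
open import Function using (_∘_)
open import Relation.Nullary using (¬_; Dec; yes; no; does; proof)
open import Relation.Nullary.Reflects using (Reflects; invert)
open import Relation.Nullary.Decidable using (_×-dec_; _⊎-dec_; dec-true; dec-false)
open import Relation.Binary.PropositionalEquality
open import Algebra.Properties.AbelianGroup ℚ.+-0-abelianGroup using (⁻¹-anti-homo‿-)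

-- Counting functions

count-suc-≤ : ∀ P n → count P (suc n) ≤ suc (count P n)
count-suc-≤ P n with P (suc n)
... | true  = ≤-refl
... | false = n≤1+n _

count-≤ : ∀ P n → count P n ≤ n
count-≤ P zero    = z≤n
count-≤ P (suc n) = ≤-trans (count-suc-≤ P n) (s≤s (count-≤ P n))

count-mono : ∀ P {m n} → m ≤ n → count P m ≤ count P n
count-mono P {m} m≤n with m≤n⇒∃[o]m+o≡n m≤n
... | d , refl = go d
  where
  step : ∀ n → count P n ≤ count P (suc n)
  step n with P (suc n)
  ... | true  = n≤1+n _
  ... | false = ≤-refl
  go : ∀ d → count P m ≤ count P (m + d)
  go zero    = ≤-reflexive (cong (count P) (sym (+-identityʳ m)))
  go (suc d) = ≤-trans (go d) (≤-trans (step (m + d)) (≤-reflexive (cong (count P) (sym (+-suc m d)))))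

count-+-≤ : ∀ P a d → count P (a + d) ≤ count P a + d
count-+-≤ P a zero    rewrite +-identityʳ a | +-identityʳ (count P a) = ≤-refl
count-+-≤ P a (suc d) rewrite +-suc a d | +-suc (count P a) d =
  ≤-trans (count-suc-≤ P (a + d)) (s≤s (count-+-≤ P a d))

count-false : ∀ P {a b} → a ≤ b → (∀ n → a < n → n ≤ b → P n ≡ false) → count P b ≡ count P a
count-false P {a} a≤b h with m≤n⇒∃[o]m+o≡n a≤b
... | d , refl = go d h
  where
  go : ∀ d → (∀ n → a < n → n ≤ a + d → P n ≡ false) → count P (a + d) ≡ count P a
  go zero    _ = cong (count P) (+-identityʳ a)
  go (suc d) h rewrite +-suc a d with P (suc (a + d)) in eq
  ... | true with () ← trans (sym eq) (h _ (s≤s (m≤m+n a d)) ≤-refl)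
  ... | false = go d λ n a<n n≤ → h n a<n (m≤n⇒m≤1+n n≤)

count-true : ∀ P a d → (∀ i → i < d → P (a + suc i) ≡ true) → count P (a + d) ≡ count P a + d
count-true P a zero    _ rewrite +-identityʳ a | +-identityʳ (count P a) = refl
count-true P a (suc d) h rewrite +-suc a d | +-suc (count P a) d
  with P (suc (a + d)) in eq
... | true  = cong suc (count-true P a d λ i i<d → h i (m<n⇒m<1+n i<d))
... | false with () ← trans (sym eq) (subst (λ n → P n ≡ true) (+-suc a d) (h d ≤-refl))

count-sparse : ∀ P a ℓ U → (∀ u i → u < U → i < ℓ → P (a + u * suc ℓ + suc i) ≡ false) →
               count P (a + U * suc ℓ) ≤ count P a + U
count-sparse P a ℓ zero    _ = ≤-reflexive (trans (cong (count P) (+-identityʳ a)) (sym (+-identityʳ _)))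
count-sparse P a ℓ (suc U) h = begin
  count P (a + suc U * suc ℓ)        ≡⟨ cong (count P) (shift a (U * suc ℓ) ℓ) ⟩
  count P (suc (a + U * suc ℓ + ℓ))  ≤⟨ count-suc-≤ P _ ⟩
  suc (count P (a + U * suc ℓ + ℓ))  ≡⟨ cong suc (count-false P (m≤m+n _ ℓ) gap) ⟩
  suc (count P (a + U * suc ℓ))      ≤⟨ s≤s (count-sparse P a ℓ U λ u i u<U → h u i (m<n⇒m<1+n u<U)) ⟩
  suc (count P a + U)                ≡⟨ +-suc (count P a) U ⟨
  count P a + suc U                  ∎
  where
  open ≤-Reasoning
  shift : ∀ a x ℓ → a + (suc ℓ + x) ≡ suc (a + x + ℓ)
  shift = solve-∀
  gap : ∀ n → a + U * suc ℓ < n → n ≤ a + U * suc ℓ + ℓ → P n ≡ false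
  gap n lo hi with m≤n⇒∃[o]m+o≡n lo
  ... | i , refl = subst (λ n → P n ≡ false) (+-suc x i)
                      (h U i ≤-refl (+-cancelˡ-≤ x (suc i) ℓ (subst (_≤ x + ℓ) (sym (+-suc x i)) hi)))
    where
    x : ℕ
    x = a + U * suc ℓ

-- Sumsets

⊕-intro : ∀ {B C a b} → B a ≡ true → C b ≡ true → (B ⊕ C) (a + b) ≡ true
⊕-intro {B} {C} {a} {b} Ba Cb =
  upTo (a + b) (m≤m+n a b) (subst (λ n → C n ≡ true) (sym (m+n∸m≡n a b)) Cb)
  where
  upTo : ∀ m → a ≤ m → C (a + b ∸ a) ≡ true → sumsetUpTo B C (a + b) m ≡ true
  upTo zero    z≤n Cb′ rewrite Ba | Cb′ = refl
  upTo (suc m) a≤m Cb′ with a ≟ suc m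
  ... | yes refl rewrite Ba | Cb′ = refl
  ... | no a≢m rewrite upTo m (≤-pred (≤∧≢⇒< a≤m a≢m)) Cb′ = ∨-zeroʳ _

⊕-elim : ∀ {B C n} → (B ⊕ C) n ≡ true → ∃[ a ] ∃[ b ] a + b ≡ n × B a ≡ true × C b ≡ true
⊕-elim {B} {C} {n} = upTo n ≤-refl
  where
  Split : Set
  Split = ∃[ a ] ∃[ b ] a + b ≡ n × B a ≡ true × C b ≡ true
  found : ∀ a → a ≤ n → B a ∧ C (n ∸ a) ≡ true → Split
  found a a≤n e with B a in eB | C (n ∸ a) in eC
  found a a≤n refl | true | true = a , n ∸ a , m+[n∸m]≡n a≤n , eB , eC
  upTo : ∀ m → m ≤ n → sumsetUpTo B C n m ≡ true → Split
  upTo zero    _   e = found zero z≤n e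
  upTo (suc m) m≤n e with B (suc m) ∧ C (n ∸ suc m) in eq
  ... | true  = found (suc m) m≤n eq
  ... | false = upTo m (<⇒≤ m≤n) e

-- Rationals

/-≤-cross : ∀ a b c d → a * suc d ≤ c * suc b → + a ℚ./ suc b ℚ.≤ + c ℚ./ suc d
/-≤-cross a b c d h = ℚ.toℚᵘ-cancel-≤
  (ℚᵘ.≤-respˡ-≃ (ℚᵘ.≃-sym (ℚ.toℚᵘ-fromℚᵘ (mkℚᵘ (+ a) b)))
    (ℚᵘ.≤-respʳ-≃ (ℚᵘ.≃-sym (ℚ.toℚᵘ-fromℚᵘ (mkℚᵘ (+ c) d)))
      (*≤* (subst₂ ℤ._≤_ (ℤ.pos-* a (suc d)) (ℤ.pos-* c (suc b)) (+≤+ h)))))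

/-<-cross : ∀ a b c d → a * suc d < c * suc b → + a ℚ./ suc b ℚ.< + c ℚ./ suc d
/-<-cross a b c d h = ℚ.toℚᵘ-cancel-<
  (ℚᵘ.<-respˡ-≃ (ℚᵘ.≃-sym (ℚ.toℚᵘ-fromℚᵘ (mkℚᵘ (+ a) b)))
    (ℚᵘ.<-respʳ-≃ (ℚᵘ.≃-sym (ℚ.toℚᵘ-fromℚᵘ (mkℚᵘ (+ c) d)))
      (*<* (subst₂ ℤ._<_ (ℤ.pos-* a (suc d)) (ℤ.pos-* c (suc b)) (+<+ h)))))

∃1/suc<pos : ∀ {ε} → 0ℚ ℚ.< ε → ∃[ n ] + 1 ℚ./ suc n ℚ.< ε
∃1/suc<pos {mkℚ (+ zero)  _ _} (*<* (+<+ ()))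
∃1/suc<pos {mkℚ -[1+ _ ]  _ _} (*<* ())
∃1/suc<pos {ε@(mkℚ (+ suc p) d _)} _ =
  suc d , subst (+ 1 ℚ./ suc (suc d) ℚ.<_) (ℚ.↥p/↧p≡p ε) (/-<-cross 1 (suc d) (suc p) d 1+d<)
  where
  1+d< : 1 * suc d < suc p * suc (suc d)
  1+d< = subst (_< suc p * suc (suc d)) (sym (*-identityˡ (suc d)))
               (<-≤-trans (n<1+n (suc d)) (m≤n*m (suc (suc d)) (suc p)))

p-q≤p : ∀ p {q} → 0ℚ ℚ.≤ q → p ℚ.- q ℚ.≤ p
p-q≤p p {q} 0≤q = begin
  p ℚ.- q    ≤⟨ ℚ.+-monoʳ-≤ p (ℚ.neg-antimono-≤ 0≤q) ⟩
  p ℚ.- 0ℚ   ≡⟨ ℚ.+-identityʳ p ⟩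
  p          ∎
  where open ℚ.≤-Reasoning

∣p-q∣≤r : ∀ {p q r} → 0ℚ ℚ.≤ p → p ℚ.≤ r → 0ℚ ℚ.≤ q → q ℚ.≤ r → ∣ p ℚ.- q ∣ ℚ.≤ r
∣p-q∣≤r {p} {q} 0≤p p≤r 0≤q q≤r with ℚ.∣p∣≡p∨∣p∣≡-p (p ℚ.- q)
... | inj₁ eq = subst (ℚ._≤ _) (sym eq) (ℚ.≤-trans (p-q≤p p 0≤q) p≤r)
... | inj₂ eq = subst (ℚ._≤ _) (sym (trans eq (⁻¹-anti-homo‿- p q))) (ℚ.≤-trans (p-q≤p q 0≤p) q≤r)

ratio-nonneg : ∀ P m → 0ℚ ℚ.≤ ratio P m
ratio-nonneg P m = /-≤-cross 0 0 (count P (suc m)) m z≤n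

DensityZero : Subset → Set
DensityZero P = ∀ d → ∃[ N ] ∀ m → m ≥ N → count P (suc m) * suc d ≤ suc m

densityZero⇒densityExists : ∀ {P} → DensityZero P → DensityExists P
densityZero⇒densityExists {P} zero-density ε 0<ε with ∃1/suc<pos 0<ε
... | d , δ<ε with zero-density d
...   | N , small = N , λ m n m≥N n≥N →
  ℚ.≤-<-trans (∣p-q∣≤r (ratio-nonneg P m) (≤δ m m≥N) (ratio-nonneg P n) (≤δ n n≥N)) δ<ε
  where
  ≤δ : ∀ m → m ≥ N → ratio P m ℚ.≤ + 1 ℚ./ suc d
  ≤δ m m≥N = /-≤-cross (count P (suc m)) m 1 d
               (≤-trans (small m m≥N) (≤-reflexive (sym (*-identityˡ (suc m)))))

-- The set A

bracket : ∀ (f : ℕ → ℕ) → (∀ k → f k < f (suc k)) →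
          ∀ {n} → f 0 ≤ n → ∃[ k ] f k ≤ n × n < f (suc k)
bracket f f-< f0≤n with m≤n⇒∃[o]m+o≡n f0≤n
... | d , refl = go d
  where
  go : ∀ d → ∃[ k ] f k ≤ f 0 + d × f 0 + d < f (suc k)
  go zero rewrite +-identityʳ (f 0) = 0 , ≤-refl , f-< 0
  go (suc d) rewrite +-suc (f 0) d with go d
  ... | k , lo , hi with suc (f 0 + d) <? f (suc k)
  ...   | yes lt = k , m≤n⇒m≤1+n lo , lt
  ...   | no ≮  = suc k , ≮⇒≥ ≮ , ≤-<-trans hi (f-< (suc k))

-- L k = 4 ^ k, written as a successor so that L k is visibly nonzero.
ℓ : ℕ → ℕ
ℓ zero    = 0
ℓ (suc k) = 3 + 4 * ℓ k

L : ℕ → ℕ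
L k = suc (ℓ k)

X : ℕ → ℕ
X k = L k * L k

L-suc : ∀ k → L (suc k) ≡ 4 * L k
L-suc k = sym (*-suc 4 (ℓ k))

X-suc : ∀ k → X (suc k) ≡ 16 * X k
X-suc k = trans (cong₂ _*_ (L-suc k) (L-suc k)) (square (L k))
  where
  square : ∀ l → 4 * l * (4 * l) ≡ 16 * (l * l)
  square = solve-∀

k<L : ∀ k → k < L k
k<L zero    = s≤s z≤n
k<L (suc k) = s≤s (s≤s (≤-trans (≤-pred (k<L k)) (≤-trans (m≤n*m (ℓ k) 4) (m≤n+m _ 2))))

L-mono : ∀ {j k} → j ≤ k → L j ≤ L k
L-mono {zero}  _         = s≤s z≤n
L-mono (s≤s j≤k) = s≤s (+-monoʳ-≤ 3 (*-monoʳ-≤ 4 (≤-pred (L-mono j≤k))))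

X-mono : ∀ {j k} → j ≤ k → X j ≤ X k
X-mono j≤k = *-mono-≤ (L-mono j≤k) (L-mono j≤k)

L≤X : ∀ k → L k ≤ X k
L≤X k = m≤m*n (L k) (L k)

k<X : ∀ k → k < X k
k<X k = <-≤-trans (k<L k) (L≤X k)

X+X<X-suc : ∀ k → X k + X k < X (suc k)
X+X<X-suc k = subst (X k + X k <_) (sym (X-suc k)) (lemma (pred (X k)))
  where
  split : ∀ y → 16 * suc y ≡ suc y + suc y + suc (13 + 14 * y)
  split = solve-∀
  lemma : ∀ y → suc y + suc y < 16 * suc y
  lemma y = subst (suc y + suc y <_) (sym (split y)) (m<m+n _ (s≤s z≤n))

X-< : ∀ k → X k < X (suc k)
X-< k = <-trans (m<m+n (X k) (s≤s z≤n)) (X+X<X-suc k)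

X-index-≤ : ∀ j k {n} → X j ≤ n → n < X (suc k) → j ≤ k
X-index-≤ j k lo hi = ≮⇒≥ λ k<j → <⇒≱ hi (≤-trans (X-mono k<j) lo)

InBlock : ℕ → ℕ → Set
InBlock k n = X k ≤ n × n < X k + X k × (n ∸ X k < L k ⊎ L k ∣ n ∸ X k)

inBlock? : ∀ k n → Dec (InBlock k n)
inBlock? k n = X k ≤? n ×-dec (n <? X k + X k) ×-dec ((n ∸ X k <? L k) ⊎-dec (L k ∣? n ∸ X k))

-- Only blocks k ≤ n need to be searched, since k < X k.
inSomeBlock? : ∀ n → Dec (∃ λ (k : Fin (suc n)) → InBlock (toℕ k) n)
inSomeBlock? n = any? λ k → inBlock? (toℕ k) n

A : Subset
A n = does (inSomeBlock? n)

A-block : ∀ {n} → A n ≡ true → ∃[ k ] InBlock k n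
A-block {n} e with invert (subst (Reflects _) e (proof (inSomeBlock? n)))
... | k , b = toℕ k , b

inBlock⇒A : ∀ k {n} → InBlock k n → A n ≡ true
inBlock⇒A k {n} b@(X≤n , _) =
  dec-true (inSomeBlock? n) (fromℕ< k<1+n , subst (λ j → InBlock j n) (sym (toℕ-fromℕ< k<1+n)) b)
  where
  k<1+n : k < suc n
  k<1+n = s≤s (<⇒≤ (<-≤-trans (k<X k) X≤n))

A-false : ∀ {n} → (∀ k → ¬ InBlock k n) → A n ≡ false
A-false {n} ¬b = dec-false (inSomeBlock? n) λ (k , b) → ¬b (toℕ k) b

inBlock-unique : ∀ j k {n} → InBlock j n → X k ≤ n → n < X (suc k) → j ≡ k
inBlock-unique j k (X≤n , n<2X , _) lo hi =
  ≤-antisym (X-index-≤ j k X≤n hi) (X-index-≤ k j lo (<-trans n<2X (X+X<X-suc j)))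

A-false-in-bracket : ∀ k {n} → X k ≤ n → n < X (suc k) → ¬ InBlock k n → A n ≡ false
A-false-in-bracket k {n} lo hi ¬b =
  A-false λ j b → ¬b (subst (λ j → InBlock j n) (inBlock-unique j k b lo hi) b)

A-gap : ∀ k {n} → X k + X k ≤ n → n < X (suc k) → A n ≡ false
A-gap k 2X≤n hi =
  A-false-in-bracket k (≤-trans (m≤m+n (X k) (X k)) 2X≤n) hi λ (_ , n<2X , _) → <⇒≱ n<2X 2X≤n

A-off-grid : ∀ k o → o < X k → L k ≤ o → ¬ (L k ∣ o) → A (X k + o) ≡ false
A-off-grid k o o<X L≤o L∤o =
  A-false-in-bracket k (m≤m+n (X k) o) (<-trans (+-monoʳ-< (X k) o<X) (X+X<X-suc k)) λ where
    (_ , _ , inj₁ o<L) → <⇒≱ (subst (_< L k) (m+n∸m≡n (X k) o) o<L) L≤o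
    (_ , _ , inj₂ L∣o) → L∤o (subst (L k ∣_) (m+n∸m≡n (X k) o) L∣o)

A-on-grid : ∀ k o → o < X k → o < L k ⊎ L k ∣ o → A (X k + o) ≡ true
A-on-grid k o o<X on-grid = inBlock⇒A k (m≤m+n (X k) o , +-monoʳ-< (X k) o<X ,
  subst (λ o′ → o′ < L k ⊎ L k ∣ o′) (sym (m+n∸m≡n (X k) o)) on-grid)

A-positive : ∀ {n} → A n ≡ true → 0 < n
A-positive e with A-block e
... | k , X≤n , _ = <-≤-trans (s≤s z≤n) X≤n

A-below : ∀ k {n} → A n ≡ true → n < X (suc k) → n < X k + X k
A-below k e n<X with A-block e
... | j , X≤n , n<2X , _ = <-≤-trans n<2X (+-mono-≤ Xj≤Xk Xj≤Xk)
  where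
  Xj≤Xk : X j ≤ X k
  Xj≤Xk = X-mono (X-index-≤ j k X≤n n<X)

count-A-X : ∀ k → count A (X k) ≤ L k
count-A-X zero    = count-≤ A 1
count-A-X (suc k) = begin
  count A (X (suc k))                ≤⟨ count-suc-≤ A (pred (X (suc k))) ⟩
  suc (count A (pred (X (suc k))))   ≡⟨ cong suc (count-false A (<⇒≤pred (X+X<X-suc k)) gap) ⟩
  suc (count A (X k + X k))          ≡⟨ cong (suc ∘ count A) (+-assoc (X k) (L k) (ℓ k * L k)) ⟨
  suc (count A (X k + L k + ℓ k * L k))
    ≤⟨ s≤s (count-sparse A (X k + L k) (ℓ k) (ℓ k) off-grid) ⟩
  suc (count A (X k + L k) + ℓ k)    ≤⟨ s≤s (+-monoˡ-≤ (ℓ k) (count-+-≤ A (X k) (L k))) ⟩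
  suc (count A (X k) + L k + ℓ k)    ≤⟨ s≤s (+-monoˡ-≤ (ℓ k) (+-monoˡ-≤ (L k) (count-A-X k))) ⟩
  suc (L k + L k + ℓ k)              ≤⟨ m≤m+n _ (L k) ⟩
  suc (L k + L k + ℓ k) + L k        ≡⟨ three-quarters (ℓ k) ⟩
  4 * L k                            ≡⟨ L-suc k ⟨
  L (suc k)                          ∎
  where
  open ≤-Reasoning
  three-quarters : ∀ l → suc (suc l + suc l + l) + suc l ≡ 4 * suc l
  three-quarters = solve-∀
  gap : ∀ n → X k + X k < n → n ≤ pred (X (suc k)) → A n ≡ false
  gap n lo hi = A-gap k (<⇒≤ lo) (s≤s hi)
  reassoc : ∀ x l u i → x + l + u * l + i ≡ x + (l + u * l + i)
  reassoc = solve-∀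
  off-grid : ∀ u i → u < ℓ k → i < ℓ k → A (X k + L k + u * L k + suc i) ≡ false
  off-grid u i u<ℓ i<ℓ = subst (λ n → A n ≡ false) (sym (reassoc (X k) (L k) u (suc i)))
    (A-off-grid k (suc u * L k + suc i)
      (≤-trans (+-mono-≤-< (*-monoˡ-≤ (L k) u<ℓ) (s≤s i<ℓ)) (≤-reflexive (+-comm (ℓ k * L k) (L k))))
      (≤-trans (m≤m+n (L k) (u * L k)) (m≤m+n _ (suc i)))
      λ L∣o → >⇒∤ (s≤s i<ℓ) (∣m+n∣m⇒∣n L∣o (n∣m*n (suc u))))

count-A-bound : ∀ j n → X j ≤ n → count A n * L j ≤ 4 * n
count-A-bound j n X≤n =
  let k , Xk≤n , n<X = bracket X X-< (≤-trans (X-mono {0} {j} z≤n) X≤n) in begin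
  count A n * L j            ≤⟨ *-mono-≤ (count-mono A (<⇒≤ n<X)) (L-mono (X-index-≤ j k X≤n n<X)) ⟩
  count A (X (suc k)) * L k  ≤⟨ *-monoˡ-≤ (L k) (count-A-X (suc k)) ⟩
  L (suc k) * L k            ≡⟨ cong (_* L k) (L-suc k) ⟩
  4 * L k * L k              ≡⟨ *-assoc 4 (L k) (L k) ⟩
  4 * X k                    ≤⟨ *-monoʳ-≤ 4 Xk≤n ⟩
  4 * n                      ∎
  where open ≤-Reasoning

A-densityZero : DensityZero A
A-densityZero d = X (suc d) , λ m m≥X → *-cancelˡ-≤ 4 (begin
  4 * (count A (suc m) * suc d)    ≡⟨ swap (count A (suc m)) (suc d) ⟩
  count A (suc m) * (4 * suc d)    ≤⟨ *-monoʳ-≤ (count A (suc m)) 4[1+d]≤L ⟩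
  count A (suc m) * L (suc d)      ≤⟨ count-A-bound (suc d) (suc m) (m≤n⇒m≤1+n m≥X) ⟩
  4 * suc m                        ∎)
  where
  open ≤-Reasoning
  swap : ∀ c e → 4 * (c * e) ≡ c * (4 * e)
  swap = solve-∀
  4[1+d]≤L : 4 * suc d ≤ L (suc d)
  4[1+d]≤L = ≤-trans (*-monoʳ-≤ 4 (k<L d)) (≤-reflexive (sym (L-suc d)))

-- The sumset A + A

A⊕A-full : ∀ k i → i < X k → (A ⊕ A) (X k + X k + i) ≡ true
A⊕A-full k i i<X = subst (λ n → (A ⊕ A) n ≡ true) sum≡
  (⊕-intro {A} {A} {X k + r} {X k + q}
    (A-on-grid k r (<-≤-trans (m%n<n i (L k)) (L≤X k)) (inj₁ (m%n<n i (L k))))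
    (A-on-grid k q (≤-<-trans (m/n*n≤m i (L k)) i<X) (inj₂ (n∣m*n (i / L k)))))
  where
  r q : ℕ
  r = i % L k
  q = i / L k * L k
  regroup : ∀ x r q → x + r + (x + q) ≡ x + x + (r + q)
  regroup = solve-∀
  sum≡ : X k + r + (X k + q) ≡ X k + X k + i
  sum≡ = trans (regroup (X k) r q) (cong (_+_ (X k + X k)) (sym (m≡m%n+[m/n]*n i (L k))))

A⊕A-below : ∀ k {n} → (A ⊕ A) n ≡ true → n ≤ X (suc k) → n < 4 * X k
A⊕A-below k {n} e n≤X with ⊕-elim {A} {A} {n} e
... | a , b , refl , Aa , Ab = subst (a + b <_) (four (X k))
  (+-mono-< (A-below k Aa (<-≤-trans (m<m+n a (A-positive Ab)) n≤X))
            (A-below k Ab (<-≤-trans (m<n+m b (A-positive Aa)) n≤X)))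
  where
  four : ∀ x → (x + x) + (x + x) ≡ 4 * x
  four = solve-∀

count-A⊕A-X-suc : ∀ k → count (A ⊕ A) (X (suc k)) ≤ 4 * X k
count-A⊕A-X-suc k = begin
  count (A ⊕ A) (X (suc k))   ≡⟨ count-false (A ⊕ A) 4X≤X-suc absent ⟩
  count (A ⊕ A) (4 * X k)     ≤⟨ count-≤ (A ⊕ A) (4 * X k) ⟩
  4 * X k                     ∎
  where
  open ≤-Reasoning
  4X≤X-suc : 4 * X k ≤ X (suc k)
  4X≤X-suc = ≤-trans (*-monoˡ-≤ (X k) {4} {16} (m≤m+n 4 12)) (≤-reflexive (sym (X-suc k)))
  absent : ∀ n → 4 * X k < n → n ≤ X (suc k) → (A ⊕ A) n ≡ false
  absent n lo hi = ¬-not λ e → <-asym lo (A⊕A-below k e hi)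

A⊕A-ratio-≤¼ : ∀ N → ∃ λ m → m ≥ N × ratio (A ⊕ A) m ℚ.≤ + 1 ℚ./ 4
A⊕A-ratio-≤¼ N = m , N≤m , /-≤-cross (count (A ⊕ A) (X (suc N))) m 1 3 (begin
  count (A ⊕ A) (X (suc N)) * 4   ≤⟨ *-monoˡ-≤ 4 (count-A⊕A-X-suc N) ⟩
  4 * X N * 4                     ≡⟨ sixteen (X N) ⟩
  16 * X N                        ≡⟨ X-suc N ⟨
  X (suc N)                       ≡⟨ *-identityˡ (X (suc N)) ⟨
  1 * X (suc N)                   ∎)
  where
  open ≤-Reasoning
  m : ℕ
  m = pred (X (suc N))
  N≤m : N ≤ m
  N≤m = <⇒≤pred (<-trans (k<X N) (X-< N))
  sixteen : ∀ x → 4 * x * 4 ≡ 16 * x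
  sixteen = solve-∀

A⊕A-ratio-≥⅓ : ∀ N → ∃ λ n → n ≥ N × + 1 ℚ./ 3 ℚ.≤ ratio (A ⊕ A) n
A⊕A-ratio-≥⅓ N = n , N≤n , /-≤-cross 1 2 (count (A ⊕ A) (suc n)) n (begin
  1 * (X N + X N + X N)           ≡⟨ triple (X N) ⟩
  X N * 3                         ≤⟨ *-monoˡ-≤ 3 X≤count ⟩
  count (A ⊕ A) (suc n) * 3       ∎)
  where
  open ≤-Reasoning
  -- As X N is a successor, suc a reduces to X N + X N and suc n to X N + X N + X N.
  a n : ℕ
  a = pred (X N) + X N
  n = a + X N
  full : ∀ i → i < X N → (A ⊕ A) (a + suc i) ≡ true
  full i i<X = subst (λ n → (A ⊕ A) n ≡ true) (sym (+-suc a i)) (A⊕A-full N i i<X)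
  N≤n : N ≤ n
  N≤n = ≤-trans (<⇒≤pred (k<X N)) (≤-trans (m≤m+n _ (X N)) (m≤m+n a (X N)))
  triple : ∀ x → 1 * (x + x + x) ≡ x * 3
  triple = solve-∀
  X≤count : X N ≤ count (A ⊕ A) (suc n)
  X≤count = begin
    X N                       ≤⟨ m≤n+m (X N) _ ⟩
    count (A ⊕ A) a + X N     ≡⟨ count-true (A ⊕ A) a (X N) full ⟨
    count (A ⊕ A) n           ≤⟨ count-mono (A ⊕ A) (n≤1+n n) ⟩
    count (A ⊕ A) (suc n)     ∎

proposition2 : Σ Subset λ A → DensityExists A × LowerLtUpper (A ⊕ A)
proposition2 =
  A , densityZero⇒densityExists {A} A-densityZero ,
  + 1 ℚ./ 4 , + 1 ℚ./ 3 , /-<-cross 1 3 1 2 ≤-refl , A⊕A-ratio-≤¼ , A⊕A-ratio-≥⅓
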